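{- Every clutter that is minimally non-packing with respect to deletion is non-separable.
   Context: A clutter on a finite set $E$ is a family of subsets none containing another (members: hyperedges). $\mathrm{bn}(\mathcal{C})$ is the minimum size of an inclusion-minimal set meeting all hyperedges; $\mathrm{pn}(\mathcal{C})$ the maximum number of pairwise disjoint hyperedges; $\mathcal{C}$ packs if $\mathrm{pn}=\mathrm{bn}$. For $A\subseteq E$, $\mathcal{C}\setminus A=\{X\in\mathcal{C}:X\cap A=\emptyset\}$; $\mathcal{C}$ is minimally non-packing with respect to deletion if it does not pack but $\mathcal{C}\setminus A$ packs for every nonempty $A\subseteq E$. With $\mathcal{C}[F]=\{X\in\mathcal{C}:X\subseteq F\}$, $\mathcal{C}$ is separable if some partition $\{E_1,E_2\}$ of $E$ into nonempty parts has $\mathrm{bn}(\mathcal{C})=\mathrm{bn}(\mathcal{C}[E_1])+\mathrm{bn}(\mathcal{C}[E_2])$; otherwise non-separable. -}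

module Defs where

open import Data.Nat using (ℕ; _≤_; _+_)
open import Data.Fin using (Fin)
open import Data.Fin.Subset using (Subset; _⊆_; _⊂_; _∩_; _∪_; Nonempty; Empty; ∣_∣; ⊥; ⊤)
open import Data.Fin.Subset.Properties using (nonempty?; _⊆?_)
open import Data.List using (List; filter; length)
open import Data.List.Membership.Propositional using (_∈_)
open import Data.List.Relation.Unary.All using (All)
open import Data.List.Relation.Unary.AllPairs using (AllPairs)
open import Data.Product using (Σ; ∃; _×_; _,_)
open import Relation.Binary.PropositionalEquality using (_≡_; _≢_)
open import Relation.Nullary using (¬_)
open import Relation.Nullary.Decidable using (¬?)

Family : ℕ → Set
Family n = List (Subset n)

-- Clutter: no member contains another member (listed at a different position);
-- in particular members are pairwise distinct.
IsClutter : ∀ {n} → Family n → Set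
IsClutter C = AllPairs (λ X Y → ¬ (X ⊆ Y) × ¬ (Y ⊆ X)) C

IsCover : ∀ {n} → Family n → Subset n → Set
IsCover C B = ∀ {X} → X ∈ C → Nonempty (X ∩ B)

IsMinimalCover : ∀ {n} → Family n → Subset n → Set
IsMinimalCover C B = IsCover C B × (∀ B′ → B′ ⊂ B → ¬ IsCover C B′)

-- bn(C) = k : k is the minimum size of an inclusion-minimal cover.
-- (If no cover exists, i.e. ∅ ∈ C, then bn(C) = k holds for no k.)
IsBn : ∀ {n} → Family n → ℕ → Set
IsBn C k = (Σ _ λ B → IsMinimalCover C B × ∣ B ∣ ≡ k)
         × (∀ B → IsMinimalCover C B → k ≤ ∣ B ∣)

IsPacking : ∀ {n} → Family n → List (Subset n) → Set
IsPacking C P = All (_∈ C) P × AllPairs (λ X Y → X ≢ Y × Empty (X ∩ Y)) P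

IsPn : ∀ {n} → Family n → ℕ → Set
IsPn C k = (Σ _ λ P → IsPacking C P × length P ≡ k)
         × (∀ P → IsPacking C P → length P ≤ k)

Packs : ∀ {n} → Family n → Set
Packs C = ∃ λ k → IsBn C k × IsPn C k

_∖_ : ∀ {n} → Family n → Subset n → Family n
C ∖ A = filter (λ X → ¬? (nonempty? (X ∩ A))) C

_[_] : ∀ {n} → Family n → Subset n → Family n
C [ F ] = filter (λ X → X ⊆? F) C

MinimallyNonPackingDeletion : ∀ {n} → Family n → Set
MinimallyNonPackingDeletion {n} C =
  ¬ Packs C × (∀ (A : Subset n) → Nonempty A → Packs (C ∖ A))

IsPartition2 : ∀ {n} → Subset n → Subset n → Set
IsPartition2 E₁ E₂ = Nonempty E₁ × Nonempty E₂ × Empty (E₁ ∩ E₂) × E₁ ∪ E₂ ≡ ⊤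

Separable : ∀ {n} → Family n → Set
Separable C = ∃ λ E₁ → ∃ λ E₂ → IsPartition2 E₁ E₂ ×
  ∃ λ k₁ → ∃ λ k₂ → IsBn C (k₁ + k₂) × IsBn (C [ E₁ ]) k₁ × IsBn (C [ E₂ ]) k₂

NonSeparable : ∀ {n} → Family n → Set
NonSeparable C = ¬ Separable C

-- Deleting E₂ leaves exactly
-- the hyperedges inside E₁, so C ∖ E₂ = C[E₁] packs by minimality, and likewise C[E₂] packs.
-- Maximum packings of the two sides lie in disjoint parts of E, so together they form a packing
-- of C of size bn(C); since no packing exceeds a cover, pn(C) = bn(C) and C packs after all.
module Submission where

open import Defs
open import Data.Nat using (ℕ; _≤_; _+_; z≤n; s≤s)
open import Data.Nat.Properties using (≤-trans; ≤-antisym)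
open import Data.Fin.Subset
  using (Subset; _⊆_; _∩_; _∪_; _─_; Nonempty; Empty; ∣_∣; ⊤) renaming (_∈_ to _∈ₛ_)
open import Data.Fin.Subset.Properties
  using (nonempty?; _⊆?_; ∈⊤; x∈p∩q⁺; x∈p∩q⁻; x∈p∪q⁻; x∈p∧x∉q⇒x∈p─q; p∩q≢∅⇒∣p─q∣<∣p∣; ∩-comm; ∪-comm)
open import Data.List using (List; []; _∷_; length; _++_)
open import Data.List.Properties using (length-++)
open import Data.List.Membership.Propositional using (_∈_)
open import Data.List.Membership.Propositional.Properties using (∈-filter⁺; ∈-filter⁻)
import Data.List.Relation.Binary.Subset.Propositional as List
open import Data.List.Relation.Unary.All as All using (All; []; _∷_)
import Data.List.Relation.Unary.All.Properties as All
open import Data.List.Relation.Unary.AllPairs as AllPairs using (AllPairs; []; _∷_)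
import Data.List.Relation.Unary.AllPairs.Properties as AllPairs
open import Data.Empty using (⊥-elim)
open import Data.Product using (∃; _×_; _,_; proj₁; proj₂)
open import Data.Sum using (inj₁; inj₂)
open import Function using (_∘_)
open import Relation.Binary.PropositionalEquality using (_≡_; _≢_; refl; sym; subst; cong₂)
open import Relation.Nullary.Decidable using (¬?)

private
  variable
    n k : ℕ
    C D : Family n
    B X Y E₁ E₂ : Subset n
    P Q : List (Subset n)

nonempty-disjoint⇒≢ : Nonempty X → Empty (X ∩ Y) → X ≢ Y
nonempty-disjoint⇒≢ (z , z∈X) X∩Y≡∅ refl = X∩Y≡∅ (z , x∈p∩q⁺ (z∈X , z∈X))

⊆-disjoint : X ⊆ E₁ → Y ⊆ E₂ → Empty (E₁ ∩ E₂) → Empty (X ∩ Y)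
⊆-disjoint {X = X} {Y = Y} X⊆E₁ Y⊆E₂ E₁∩E₂≡∅ (z , z∈X∩Y) =
  E₁∩E₂≡∅ (z , x∈p∩q⁺ (X⊆E₁ (proj₁ z∈) , Y⊆E₂ (proj₂ z∈)))
  where z∈ = x∈p∩q⁻ X Y z∈X∩Y

disjoint-from-complement⇒⊆ : E₁ ∪ E₂ ≡ ⊤ → Empty (X ∩ E₂) → X ⊆ E₁
disjoint-from-complement⇒⊆ {E₁ = E₁} {E₂} E₁∪E₂≡⊤ X∩E₂≡∅ {z} z∈X
  with x∈p∪q⁻ E₁ E₂ (subst (z ∈ₛ_) (sym E₁∪E₂≡⊤) ∈⊤)
... | inj₁ z∈E₁ = z∈E₁
... | inj₂ z∈E₂ = ⊥-elim (X∩E₂≡∅ (z , x∈p∩q⁺ (z∈X , z∈E₂)))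

⊆⇒disjoint-from-complement : Empty (E₁ ∩ E₂) → X ⊆ E₁ → Empty (X ∩ E₂)
⊆⇒disjoint-from-complement E₁∩E₂≡∅ X⊆E₁ = ⊆-disjoint X⊆E₁ (λ z∈ → z∈) E₁∩E₂≡∅

∈-∖⁻ : ∀ {C : Family n} {A X} → X ∈ C ∖ A → X ∈ C × Empty (X ∩ A)
∈-∖⁻ {C = C} {A} = ∈-filter⁻ (λ Y → ¬? (nonempty? (Y ∩ A))) {xs = C}

∈-∖⁺ : ∀ {C : Family n} {A X} → X ∈ C → Empty (X ∩ A) → X ∈ C ∖ A
∈-∖⁺ {A = A} = ∈-filter⁺ (λ Y → ¬? (nonempty? (Y ∩ A)))

∈-[]⁻ : ∀ {C : Family n} {A X} → X ∈ C [ A ] → X ∈ C × X ⊆ A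
∈-[]⁻ {C = C} {A} = ∈-filter⁻ (λ Y → Y ⊆? A) {xs = C}

∈-[]⁺ : ∀ {C : Family n} {A X} → X ∈ C → X ⊆ A → X ∈ C [ A ]
∈-[]⁺ {A = A} = ∈-filter⁺ (λ Y → Y ⊆? A)

module _ (E₁∩E₂≡∅ : Empty (E₁ ∩ E₂)) (E₁∪E₂≡⊤ : E₁ ∪ E₂ ≡ ⊤) where

  ∖-complement⊆[] : ∀ C → (C ∖ E₂) List.⊆ (C [ E₁ ])
  ∖-complement⊆[] C X∈ = let X∈C , X∩E₂≡∅ = ∈-∖⁻ {C = C} X∈ in
    ∈-[]⁺ X∈C (disjoint-from-complement⇒⊆ E₁∪E₂≡⊤ X∩E₂≡∅)

  []⊆∖-complement : ∀ C → (C [ E₁ ]) List.⊆ (C ∖ E₂)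
  []⊆∖-complement C X∈ = let X∈C , X⊆E₁ = ∈-[]⁻ {C = C} X∈ in
    ∈-∖⁺ X∈C (⊆⇒disjoint-from-complement E₁∩E₂≡∅ X⊆E₁)

IsCover-antimono : D List.⊆ C → IsCover C B → IsCover D B
IsCover-antimono D⊆C cover X∈D = cover (D⊆C X∈D)

IsMinimalCover-resp : C List.⊆ D → D List.⊆ C → IsMinimalCover C B → IsMinimalCover D B
IsMinimalCover-resp C⊆D D⊆C (cover , minimal) =
  IsCover-antimono D⊆C cover , λ B′ B′⊂B cover′ → minimal B′ B′⊂B (IsCover-antimono C⊆D cover′)

IsBn-resp : C List.⊆ D → D List.⊆ C → IsBn C k → IsBn D k
IsBn-resp C⊆D D⊆C ((B , minCover , ∣B∣≡k) , least) =
  (B , IsMinimalCover-resp C⊆D D⊆C minCover , ∣B∣≡k) ,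
  λ B′ minCover′ → least B′ (IsMinimalCover-resp D⊆C C⊆D minCover′)

IsBn-unique : ∀ {k′} → IsBn C k → IsBn C k′ → k ≡ k′
IsBn-unique {k = k} {k′} ((B , minCover , ∣B∣≡k) , least) ((B′ , minCover′ , ∣B′∣≡k′) , least′) =
  ≤-antisym (subst (k ≤_) ∣B′∣≡k′ (least B′ minCover′)) (subst (k′ ≤_) ∣B∣≡k (least′ B minCover))

IsCover⇒nonempty : IsCover C B → X ∈ C → Nonempty X
IsCover⇒nonempty {B = B} {X = X} cover X∈C =
  let z , z∈X∩B = cover X∈C in z , proj₁ (x∈p∩q⁻ X B z∈X∩B)

-- Pigeonhole: deleting one hyperedge X from B costs B an element, and the remaining
-- hyperedges, being disjoint from X, still meet B ─ X.
disjoint-hitting≤ : AllPairs (λ X Y → Empty (X ∩ Y)) P → All (λ X → Nonempty (X ∩ B)) P →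
  length P ≤ ∣ B ∣
disjoint-hitting≤ [] [] = z≤n
disjoint-hitting≤ {P = X ∷ P} {B = B} (X∩P≡∅ ∷ disjoint) (X∩B≢∅ ∷ hitting) =
  ≤-trans (s≤s (disjoint-hitting≤ disjoint (All.zipWith meets-B─X (X∩P≡∅ , hitting))))
          (p∩q≢∅⇒∣p─q∣<∣p∣ B X (subst Nonempty (∩-comm X B) X∩B≢∅))
  where
    meets-B─X : ∀ {Y} → Empty (X ∩ Y) × Nonempty (Y ∩ B) → Nonempty (Y ∩ (B ─ X))
    meets-B─X {Y} (X∩Y≡∅ , z , z∈Y∩B) =
      z , x∈p∩q⁺ (proj₁ z∈ , x∈p∧x∉q⇒x∈p─q (proj₂ z∈) (λ z∈X → X∩Y≡∅ (z , x∈p∩q⁺ (z∈X , proj₁ z∈))))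
      where z∈ = x∈p∩q⁻ Y B z∈Y∩B

packing≤cover : IsCover C B → IsPacking C P → length P ≤ ∣ B ∣
packing≤cover cover (P⊆C , distinct-disjoint) =
  disjoint-hitting≤ (AllPairs.map proj₂ distinct-disjoint) (All.map cover P⊆C)

packing-of-size-bn⇒Packs : IsBn C k → IsPacking C P → length P ≡ k → Packs C
packing-of-size-bn⇒Packs {P = P} bn packing ∣P∣≡k =
  _ , bn , (P , packing , ∣P∣≡k) , λ P′ packing′ →
    let B , (cover , _) , ∣B∣≡k = proj₁ bn in subst (length P′ ≤_) ∣B∣≡k (packing≤cover cover packing′)

Packs⇒packing-of-size-bn : Packs C → IsBn C k → ∃ λ P → IsPacking C P × length P ≡ k
Packs⇒packing-of-size-bn (_ , bn′ , (P , packing , ∣P∣≡k′) , _) bn =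
  P , packing , subst (length P ≡_) (IsBn-unique bn′ bn) ∣P∣≡k′

IsPacking-++ : IsPacking C P → IsPacking C Q →
  All (λ X → All (λ Y → X ≢ Y × Empty (X ∩ Y)) Q) P → IsPacking C (P ++ Q)
IsPacking-++ (P⊆C , P-pairs) (Q⊆C , Q-pairs) cross =
  All.++⁺ P⊆C Q⊆C , AllPairs.++⁺ P-pairs Q-pairs cross

IsPacking-++-separated : IsCover C B → Empty (E₁ ∩ E₂) →
  IsPacking C P → All (_⊆ E₁) P → IsPacking C Q → All (_⊆ E₂) Q → IsPacking C (P ++ Q)
IsPacking-++-separated {C = C} {E₁ = E₁} {E₂} cover E₁∩E₂≡∅ packingP P⊆E₁ packingQ Q⊆E₂ =
  IsPacking-++ packingP packingQ
    (All.zipWith (λ X∈ → All.zipWith (distinct-disjoint X∈) (proj₁ packingQ , Q⊆E₂))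
                 (proj₁ packingP , P⊆E₁))
  where
    distinct-disjoint : ∀ {X Y} → X ∈ C × X ⊆ E₁ → Y ∈ C × Y ⊆ E₂ → X ≢ Y × Empty (X ∩ Y)
    distinct-disjoint (X∈C , X⊆E₁) (_ , Y⊆E₂) =
      nonempty-disjoint⇒≢ (IsCover⇒nonempty cover X∈C) X∩Y≡∅ , X∩Y≡∅
      where X∩Y≡∅ = ⊆-disjoint X⊆E₁ Y⊆E₂ E₁∩E₂≡∅

packing-inside : Empty (E₁ ∩ E₂) → E₁ ∪ E₂ ≡ ⊤ → Packs (C ∖ E₂) → IsBn (C [ E₁ ]) k →
  ∃ λ P → IsPacking C P × All (_⊆ E₁) P × length P ≡ k
packing-inside {E₁ = E₁} {E₂} {C = C} E₁∩E₂≡∅ E₁∪E₂≡⊤ packs bn₁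
  with Packs⇒packing-of-size-bn packs
         (IsBn-resp ([]⊆∖-complement E₁∩E₂≡∅ E₁∪E₂≡⊤ C) (∖-complement⊆[] E₁∩E₂≡∅ E₁∪E₂≡⊤ C) bn₁)
... | P , (P⊆C∖E₂ , pairs) , ∣P∣≡k =
  P , (All.map (proj₁ ∘ within-E₁) P⊆C∖E₂ , pairs) , All.map (proj₂ ∘ within-E₁) P⊆C∖E₂ , ∣P∣≡k
  where
    within-E₁ : ∀ {X} → X ∈ C ∖ E₂ → X ∈ C × X ⊆ E₁
    within-E₁ X∈ = ∈-[]⁻ {C = C} (∖-complement⊆[] E₁∩E₂≡∅ E₁∪E₂≡⊤ C X∈)

lemma3p25 : ∀ (n : ℕ) (C : Family n) → IsClutter C →
    MinimallyNonPackingDeletion C → NonSeparable C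
lemma3p25 n C _ (¬packs , packs∖)
  (E₁ , E₂ , (E₁≢∅ , E₂≢∅ , E₁∩E₂≡∅ , E₁∪E₂≡⊤) , k₁ , k₂ , bn , bn₁ , bn₂)
  with packing-inside E₁∩E₂≡∅ E₁∪E₂≡⊤ (packs∖ E₂ E₂≢∅) bn₁
     | packing-inside (subst Empty (∩-comm E₁ E₂) E₁∩E₂≡∅) (subst (_≡ ⊤) (∪-comm E₁ E₂) E₁∪E₂≡⊤)
                      (packs∖ E₁ E₁≢∅) bn₂
... | P₁ , packing₁ , P₁⊆E₁ , ∣P₁∣≡k₁ | P₂ , packing₂ , P₂⊆E₂ , ∣P₂∣≡k₂ =
  ¬packs (packing-of-size-bn⇒Packs bn
    (IsPacking-++-separated cover E₁∩E₂≡∅ packing₁ P₁⊆E₁ packing₂ P₂⊆E₂) ∣P₁++P₂∣≡k₁+k₂)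
  where
    cover : IsCover C (proj₁ (proj₁ bn))
    cover = proj₁ (proj₁ (proj₂ (proj₁ bn)))

    ∣P₁++P₂∣≡k₁+k₂ : length (P₁ ++ P₂) ≡ k₁ + k₂
    ∣P₁++P₂∣≡k₁+k₂ = subst (_≡ k₁ + k₂) (sym (length-++ P₁)) (cong₂ _+_ ∣P₁∣≡k₁ ∣P₂∣≡k₂)
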